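{- Let $n$ be even, $a=n/2$, and let $Q\subseteq\{0,1\}^n$ be any set of at most $q=2^{0.01\sqrt n}$ points (the queries of a non-adaptive deterministic algorithm). Let $\mathbf A\subseteq[n]$ be uniformly random among sets of size $a$ and $\mathbf C=[n]\setminus\mathbf A$. Let $\mathsf{Bad}$ be the event that there exist $x,y\in Q$ with $x_{\mathbf C}=y_{\mathbf C}$, $|x_{\mathbf A}|>a/2+0.05\sqrt a$ and $|y_{\mathbf A}|<a/2-0.05\sqrt a$. Then $\Pr[\mathsf{Bad}]=o_n(1)$.
   Context: For $x\in\{0,1\}^n$ and $B\subseteq[n]$, $x_B$ denotes the restriction of $x$ to the coordinates in $B$, and $|\cdot|$ denotes Hamming weight. $o_n(1)$ denotes a quantity tending to $0$ as $n\to\infty$ (uniformly over the choice of $Q$). -}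

module Defs where

open import Data.Bool using (Bool; true; false; _∧_; _∨_; if_then_else_)
open import Data.Bool.Properties using () renaming (_≟_ to _≟B_)
open import Data.Nat using (ℕ; zero; suc; _+_; _*_; _∸_; _^_; _≤ᵇ_; _<ᵇ_)
open import Data.Vec using (Vec; []; _∷_; zipWith; toList)
open import Data.List using (List; []; _∷_; map; _++_; length; filterᵇ)
open import Data.Bool.ListAction using (any)
open import Relation.Nullary.Decidable using (⌊_⌋)

Point : ℕ → Set
Point n = Vec Bool n

-- A subset of [n], as its characteristic vector (true = member).
SubsetV : ℕ → Set
SubsetV n = Vec Bool n

allSubsets : (n : ℕ) → List (SubsetV n)
allSubsets zero = [] ∷ []
allSubsets (suc n) = map (true ∷_) (allSubsets n) ++ map (false ∷_) (allSubsets n)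

countTrue : ∀ {n} → Vec Bool n → ℕ
countTrue [] = 0
countTrue (true ∷ v) = suc (countTrue v)
countTrue (false ∷ v) = countTrue v

card : ∀ {n} → SubsetV n → ℕ
card = countTrue

weightOn : ∀ {n} → SubsetV n → Point n → ℕ
weightOn A x = countTrue (zipWith _∧_ A x)

-- x_C = y_C where C = [n] \ A : x and y agree on every coordinate outside A
agreeOffB : ∀ {n} → SubsetV n → Point n → Point n → Bool
agreeOffB [] [] [] = true
agreeOffB (s ∷ A) (b ∷ x) (c ∷ y) = (s ∨ ⌊ b ≟B c ⌋) ∧ agreeOffB A x y

-- w > a/2 + 0.05 √a   ⇔   20w − 10a > √a   ⇔   10a ≤ 20w ∧ a < (20w − 10a)^2
highB : ℕ → ℕ → Bool
highB a w = (10 * a ≤ᵇ 20 * w) ∧ (a <ᵇ (20 * w ∸ 10 * a) ^ 2)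

-- w < a/2 − 0.05 √a   ⇔   10a − 20w > √a   ⇔   20w ≤ 10a ∧ a < (10a − 20w)^2
lowB : ℕ → ℕ → Bool
lowB a w = (20 * w ≤ᵇ 10 * a) ∧ (a <ᵇ (10 * a ∸ 20 * w) ^ 2)

badB : ∀ {n} → ℕ → List (Point n) → SubsetV n → Bool
badB a Q A = any (λ x → any (λ y →
  agreeOffB A x y ∧ highB a (weightOn A x) ∧ lowB a (weightOn A y)) Q) Q

-- Number of a-subsets A of [n] for which Bad occurs;
-- Pr[Bad] = badCount n a Q / (n choose a).
badCount : (n a : ℕ) → List (Point n) → ℕ
badCount n a Q = length (filterᵇ (λ A → ⌊ card A Data.Nat.≟ a ⌋ ∧ badB a Q A) (allSubsets n))

-- |Q| ≤ 2^{0.01 √n}  ⇔  |Q|^100 ≤ 2^{√n}  ⇔  for all rationals p/r > √n, |Q|^{100 r} ≤ 2^p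
QueryBound : ℕ → ℕ → Set
QueryBound n s = ∀ (p r : ℕ) → 0 Data.Nat.< r → n * r ^ 2 Data.Nat.< p ^ 2 → s ^ (100 * r) Data.Nat.≤ 2 ^ p

module Submission where

-- A set A that makes a pair (x, y) of queries bad must contain the set D on which x and y
-- differ, and since |x_A| ≤ |y_A| + |D| the two thresholds force 20|D| > √(2m).  Only
-- C(2m − |D|, m − |D|) ≤ 2^{−|D|} C(2m, m) sets of size m contain D, while the query bound
-- gives |Q|^100 ≤ 2^{20|D|}; once m is large, |D| ≥ 50(k + 1) and so (k + 1)|Q|² ≤ 2^{|D|}.
-- A union bound over the |Q|² pairs finishes the proof.

open import Defs
open import Data.Nat using (ℕ; suc; _+_; _*_; _≤_)
open import Data.Nat.Combinatorics using (_C_)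
open import Data.List using (List; length)
open import Data.Product using (∃-syntax)

open import Data.Bool using (Bool; true; false; _∧_; _∨_; _xor_; not; T)
open import Data.Bool.ListAction using (any)
open import Data.Bool.Properties using (T-∧) renaming (_≟_ to _≟B_)
open import Data.Empty using (⊥-elim)
open import Data.List using ([]; _∷_; map; _++_; filterᵇ)
open import Data.List.Properties using (length-++; filter-++; filter-none)
open import Data.List.Relation.Binary.Sublist.Propositional using (⊆-refl)
open import Data.List.Relation.Binary.Sublist.Propositional.Properties using (filter⁺; length-mono-≤)
open import Data.List.Relation.Unary.All using (universal)
open import Data.List.Relation.Unary.Any using (Any; here; there)
import Data.List.Relation.Unary.Any as Any
open import Data.List.Relation.Unary.Any.Properties using (any⁻)
open import Data.Nat using (zero; _∸_; _^_; _<_; z≤n; s≤s; s≤s⁻¹; _≟_; _≤?_; _<?_; NonZero)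
open import Data.Nat.Combinatorics using (nC1≡n; nCk+nC[k+1]≡[n+1]C[k+1])
open import Data.Nat.ListAction using (sum)
open import Data.Nat.Properties
open import Data.Nat.Tactic.RingSolver using (solve-∀)
open import Data.Product using (_,_; proj₁; proj₂)
open import Data.Vec using ([]; _∷_; zipWith)
open import Function using (_∘_; case_of_; Equivalence)
open import Relation.Nullary using (¬_; yes; no; T?)
open import Relation.Nullary.Decidable using (⌊_⌋; toWitness; isYes≗does)
open import Relation.Binary.PropositionalEquality

private variable
  A B : Set

count : (A → Bool) → List A → ℕ
count p xs = length (filterᵇ p xs)

count-mono : ∀ {p q : A → Bool} → (∀ a → T (p a) → T (q a)) → ∀ xs → count p xs ≤ count q xs
count-mono {p = p} {q} p⇒q xs =
  length-mono-≤ (filter⁺ (T? ∘ p) (T? ∘ q) (λ { refl → p⇒q _ }) (⊆-refl {x = xs}))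

count-cong : ∀ {p q : A → Bool} → (∀ a → p a ≡ q a) → ∀ xs → count p xs ≡ count q xs
count-cong p≡q xs = ≤-antisym (count-mono (λ a → subst T (p≡q a)) xs)
                              (count-mono (λ a → subst T (sym (p≡q a))) xs)

count-none : ∀ {p : A → Bool} → (∀ a → ¬ T (p a)) → ∀ xs → count p xs ≡ 0
count-none {p = p} ¬p xs = cong length (filter-none (T? ∘ p) (universal ¬p xs))

count-++ : ∀ (p : A → Bool) xs ys → count p (xs ++ ys) ≡ count p xs + count p ys
count-++ p xs ys = trans (cong length (filter-++ (T? ∘ p) xs ys)) (length-++ (filterᵇ p xs))

count-map : ∀ (p : B → Bool) (f : A → B) xs → count p (map f xs) ≡ count (p ∘ f) xs
count-map p f [] = refl
count-map p f (x ∷ xs) with p (f x)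
... | true = cong suc (count-map p f xs)
... | false = count-map p f xs

count-∨ : ∀ (p q : A → Bool) xs → count (λ a → p a ∨ q a) xs ≤ count p xs + count q xs
count-∨ p q [] = z≤n
count-∨ p q (x ∷ xs) with p x | q x
... | true | true = s≤s (≤-trans (count-∨ p q xs) (+-monoʳ-≤ (count p xs) (n≤1+n _)))
... | true | false = s≤s (count-∨ p q xs)
... | false | true = ≤-trans (s≤s (count-∨ p q xs)) (≤-reflexive (sym (+-suc _ _)))
... | false | false = count-∨ p q xs

count-≤-sum : ∀ {p : A → Bool} (f : B → A → Bool) (bs : List B) →
  (∀ a → T (p a) → Any (λ b → T (f b a)) bs) →
  ∀ xs → count p xs ≤ sum (map (λ b → count (f b) xs) bs)
count-≤-sum f [] p⇒f xs = ≤-reflexive (count-none (λ a pa → case p⇒f a pa of λ ()) xs)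
count-≤-sum {p = p} f (b ∷ bs) p⇒f xs = begin
  count p xs                                     ≤⟨ count-mono split xs ⟩
  count (λ a → f b a ∨ (not (f b a) ∧ p a)) xs   ≤⟨ count-∨ (f b) _ xs ⟩
  count (f b) xs + count (λ a → not (f b a) ∧ p a) xs
    ≤⟨ +-monoʳ-≤ (count (f b) xs) (count-≤-sum f bs rest xs) ⟩
  count (f b) xs + sum (map (λ b → count (f b) xs) bs) ∎
  where
  open ≤-Reasoning
  split : ∀ a → T (p a) → T (f b a ∨ (not (f b a) ∧ p a))
  split a pa with f b a
  ... | true = _
  ... | false = pa
  rest : ∀ a → T (not (f b a) ∧ p a) → Any (λ b → T (f b a)) bs
  rest a t with p⇒f a (proj₂ (Equivalence.to T-∧ t))
  ... | there fbs = fbs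
  ... | here fba with f b a
  ...   | true = ⊥-elim t

sum-map-mono : ∀ {f g : A → ℕ} → (∀ a → f a ≤ g a) → ∀ xs → sum (map f xs) ≤ sum (map g xs)
sum-map-mono f≤g [] = z≤n
sum-map-mono f≤g (x ∷ xs) = +-mono-≤ (f≤g x) (sum-map-mono f≤g xs)

*-sum-≤-length-* : ∀ c M (f : A → ℕ) → (∀ a → c * f a ≤ M) → ∀ xs → c * sum (map f xs) ≤ length xs * M
*-sum-≤-length-* c M f bound [] = ≤-reflexive (*-zeroʳ c)
*-sum-≤-length-* c M f bound (x ∷ xs) = begin
  c * (f x + sum (map f xs))     ≡⟨ *-distribˡ-+ c (f x) _ ⟩
  c * f x + c * sum (map f xs)   ≤⟨ +-mono-≤ (bound x) (*-sum-≤-length-* c M f bound xs) ⟩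
  M + length xs * M ∎
  where open ≤-Reasoning

*-sum-≤ : ∀ c M (f : A → ℕ) xs → (∀ a → length xs * (c * f a) ≤ M) → c * sum (map f xs) ≤ M
*-sum-≤ c M f [] bound = ≤-trans (≤-reflexive (*-zeroʳ c)) z≤n
*-sum-≤ c M f xs@(_ ∷ _) bound = *-cancelˡ-≤ (length xs) (begin
  length xs * (c * sum (map f xs))   ≡⟨ *-assoc (length xs) c _ ⟨
  length xs * c * sum (map f xs)     ≤⟨ *-sum-≤-length-* (length xs * c) M f bound′ xs ⟩
  length xs * M ∎)
  where
  open ≤-Reasoning
  bound′ : ∀ a → length xs * c * f a ≤ M
  bound′ a = ≤-trans (≤-reflexive (*-assoc (length xs) c (f a))) (bound a)

[k+1]*[n+1]C[k+1]≡[n+1]*nCk : ∀ n k → suc k * (suc n C suc k) ≡ suc n * (n C k)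
[k+1]*[n+1]C[k+1]≡[n+1]*nCk zero zero = refl
[k+1]*[n+1]C[k+1]≡[n+1]*nCk zero (suc k) = *-zeroʳ (suc (suc k))
[k+1]*[n+1]C[k+1]≡[n+1]*nCk (suc n) zero =
  trans (*-identityˡ _) (trans (nC1≡n (suc (suc n))) (sym (*-identityʳ (suc (suc n)))))
[k+1]*[n+1]C[k+1]≡[n+1]*nCk (suc n) (suc k) = begin
  suc (suc k) * (suc (suc n) C suc (suc k))
    ≡⟨ cong (suc (suc k) *_) (nCk+nC[k+1]≡[n+1]C[k+1] (suc n) (suc k)) ⟨
  suc (suc k) * (X + suc n C suc (suc k))
    ≡⟨ *-distribˡ-+ (suc (suc k)) X _ ⟩
  (X + suc k * X) + suc (suc k) * (suc n C suc (suc k))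
    ≡⟨ cong₂ (λ u v → (X + u) + v) ([k+1]*[n+1]C[k+1]≡[n+1]*nCk n k) ([k+1]*[n+1]C[k+1]≡[n+1]*nCk n (suc k)) ⟩
  (X + suc n * (n C k)) + suc n * (n C suc k)
    ≡⟨ regroup X (suc n) (n C k) (n C suc k) ⟩
  X + suc n * (n C k + n C suc k)
    ≡⟨ cong (λ z → X + suc n * z) (nCk+nC[k+1]≡[n+1]C[k+1] n k) ⟩
  suc (suc n) * X ∎
  where
  open ≡-Reasoning
  X = suc n C suc k
  regroup : ∀ x a b c → (x + a * b) + a * c ≡ x + a * (b + c)
  regroup = solve-∀

2*nCk≤[n+1]C[k+1] : ∀ n k → suc k + suc k ≤ suc n → 2 * (n C k) ≤ suc n C suc k
2*nCk≤[n+1]C[k+1] n k 2k+2≤n+1 = *-cancelˡ-≤ (suc k) (begin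
  suc k * (2 * (n C k))        ≡⟨ regroup (suc k) (n C k) ⟩
  (suc k + suc k) * (n C k)    ≤⟨ *-monoˡ-≤ (n C k) 2k+2≤n+1 ⟩
  suc n * (n C k)              ≡⟨ [k+1]*[n+1]C[k+1]≡[n+1]*nCk n k ⟨
  suc k * (suc n C suc k) ∎)
  where
  open ≤-Reasoning
  regroup : ∀ a b → a * (2 * b) ≡ (a + a) * b
  regroup = solve-∀

2^d*[n∸d]C[a∸d]≤nCa : ∀ d n a → d ≤ a → a + a ≤ n → 2 ^ d * ((n ∸ d) C (a ∸ d)) ≤ n C a
2^d*[n∸d]C[a∸d]≤nCa zero n a _ _ = ≤-reflexive (+-identityʳ (n C a))
2^d*[n∸d]C[a∸d]≤nCa (suc d) (suc n) (suc a) (s≤s d≤a) 2a+2≤n+1 = begin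
  2 * 2 ^ d * ((n ∸ d) C (a ∸ d))     ≡⟨ *-assoc 2 (2 ^ d) _ ⟩
  2 * (2 ^ d * ((n ∸ d) C (a ∸ d)))   ≤⟨ *-monoʳ-≤ 2 (2^d*[n∸d]C[a∸d]≤nCa d n a d≤a a+a≤n) ⟩
  2 * (n C a)                         ≤⟨ 2*nCk≤[n+1]C[k+1] n a 2a+2≤n+1 ⟩
  suc n C suc a ∎
  where
  open ≤-Reasoning
  a+a≤n : a + a ≤ n
  a+a≤n = ≤-trans (+-monoʳ-≤ a (n≤1+n a)) (s≤s⁻¹ 2a+2≤n+1)

_⊆ᵇ_ : ∀ {n} → SubsetV n → SubsetV n → Bool
[] ⊆ᵇ [] = true
(t ∷ D) ⊆ᵇ (s ∷ A) = (s ∨ not t) ∧ (D ⊆ᵇ A)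

card≤n : ∀ {n} (D : SubsetV n) → card D ≤ n
card≤n [] = z≤n
card≤n (true ∷ D) = s≤s (card≤n D)
card≤n (false ∷ D) = m≤n⇒m≤1+n (card≤n D)

⊆ᵇ⇒card≤ : ∀ {n} (D A : SubsetV n) → T (D ⊆ᵇ A) → card D ≤ card A
⊆ᵇ⇒card≤ [] [] _ = z≤n
⊆ᵇ⇒card≤ (true ∷ D) (true ∷ A) D⊆A = s≤s (⊆ᵇ⇒card≤ D A D⊆A)
⊆ᵇ⇒card≤ (false ∷ D) (true ∷ A) D⊆A = m≤n⇒m≤1+n (⊆ᵇ⇒card≤ D A D⊆A)
⊆ᵇ⇒card≤ (false ∷ D) (false ∷ A) D⊆A = ⊆ᵇ⇒card≤ D A D⊆A

supersetsOfSize : ∀ {n} → ℕ → SubsetV n → ℕ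
supersetsOfSize {n} a D = count (λ A → ⌊ card A ≟ a ⌋ ∧ D ⊆ᵇ A) (allSubsets n)

⌊suc≟suc⌋ : ∀ m n → ⌊ suc m ≟ suc n ⌋ ≡ ⌊ m ≟ n ⌋
⌊suc≟suc⌋ m n = trans (isYes≗does (suc m ≟ suc n)) (sym (isYes≗does (m ≟ n)))

supersetsOfSize-∷ : ∀ {n} a t (D : SubsetV n) → supersetsOfSize a (t ∷ D) ≡
  count (λ A → ⌊ suc (card A) ≟ a ⌋ ∧ D ⊆ᵇ A) (allSubsets n) +
  count (λ A → ⌊ card A ≟ a ⌋ ∧ (not t ∧ D ⊆ᵇ A)) (allSubsets n)
supersetsOfSize-∷ {n} a t D = trans (count-++ _ (map (true ∷_) (allSubsets n)) _)
  (cong₂ _+_ (count-map _ (true ∷_) (allSubsets n)) (count-map _ (false ∷_) (allSubsets n)))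

supersetsOfSize-suc-card : ∀ {n} a (D : SubsetV n) →
  count (λ A → ⌊ suc (card A) ≟ suc a ⌋ ∧ D ⊆ᵇ A) (allSubsets n) ≡ supersetsOfSize a D
supersetsOfSize-suc-card {n} a D = count-cong (λ A → cong (_∧ D ⊆ᵇ A) (⌊suc≟suc⌋ (card A) a)) (allSubsets n)

shifted-supersets-none : ∀ {n} j a (D : SubsetV n) → a < j + card D →
  count (λ A → ⌊ j + card A ≟ a ⌋ ∧ D ⊆ᵇ A) (allSubsets n) ≡ 0
shifted-supersets-none {n} j a D a<j+|D| = count-none none (allSubsets n)
  where
  none : ∀ A → ¬ T (⌊ j + card A ≟ a ⌋ ∧ D ⊆ᵇ A)
  none A t with Equivalence.to T-∧ t
  ... | |A|≡a , D⊆A = <⇒≱ a<j+|D|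
    (subst (j + card D ≤_) (toWitness |A|≡a) (+-monoʳ-≤ j (⊆ᵇ⇒card≤ D A D⊆A)))

supersetsOfSize-vanish : ∀ {n} a (D : SubsetV n) → a < card D → supersetsOfSize a D ≡ 0
supersetsOfSize-vanish = shifted-supersets-none 0

supersetsOfSize-forced : ∀ {n} a (D : SubsetV n) → supersetsOfSize (suc a) (true ∷ D) ≡ supersetsOfSize a D
supersetsOfSize-forced {n} a D = begin
  supersetsOfSize (suc a) (true ∷ D)
    ≡⟨ supersetsOfSize-∷ (suc a) true D ⟩
  count (λ A → ⌊ suc (card A) ≟ suc a ⌋ ∧ D ⊆ᵇ A) (allSubsets n)
    + count (λ A → ⌊ card A ≟ suc a ⌋ ∧ (false ∧ D ⊆ᵇ A)) (allSubsets n)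
    ≡⟨ cong₂ _+_ (supersetsOfSize-suc-card a D) (count-none (λ A → proj₂ ∘ Equivalence.to T-∧) (allSubsets n)) ⟩
  supersetsOfSize a D + 0
    ≡⟨ +-identityʳ _ ⟩
  supersetsOfSize a D ∎
  where open ≡-Reasoning

supersetsOfSize-free : ∀ {n} a (D : SubsetV n) →
  supersetsOfSize (suc a) (false ∷ D) ≡ supersetsOfSize a D + supersetsOfSize (suc a) D
supersetsOfSize-free a D = trans (supersetsOfSize-∷ (suc a) false D)
  (cong (_+ supersetsOfSize (suc a) D) (supersetsOfSize-suc-card a D))

supersetsOfSize-free-minimal : ∀ {n} (D : SubsetV n) →
  supersetsOfSize (card D) (false ∷ D) ≡ supersetsOfSize (card D) D
supersetsOfSize-free-minimal D = trans (supersetsOfSize-∷ (card D) false D)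
  (cong (_+ supersetsOfSize (card D) D) (shifted-supersets-none 1 (card D) D ≤-refl))

supersetsOfSize-exact : ∀ {n} (D : SubsetV n) k → supersetsOfSize (k + card D) D ≡ (n ∸ card D) C k
supersetsOfSize-exact [] zero = refl
supersetsOfSize-exact [] (suc k) = refl
supersetsOfSize-exact (true ∷ D) k = begin
  supersetsOfSize (k + suc (card D)) (true ∷ D)   ≡⟨ cong (λ a → supersetsOfSize a (true ∷ D)) (+-suc k (card D)) ⟩
  supersetsOfSize (suc (k + card D)) (true ∷ D)   ≡⟨ supersetsOfSize-forced (k + card D) D ⟩
  supersetsOfSize (k + card D) D                  ≡⟨ supersetsOfSize-exact D k ⟩
  _ C k ∎
  where open ≡-Reasoning
supersetsOfSize-exact (false ∷ D) zero =
  trans (supersetsOfSize-free-minimal D) (supersetsOfSize-exact D zero)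
supersetsOfSize-exact {suc n} (false ∷ D) (suc k) = begin
  supersetsOfSize (suc (k + card D)) (false ∷ D)
    ≡⟨ supersetsOfSize-free (k + card D) D ⟩
  supersetsOfSize (k + card D) D + supersetsOfSize (suc k + card D) D
    ≡⟨ cong₂ _+_ (supersetsOfSize-exact D k) (supersetsOfSize-exact D (suc k)) ⟩
  (n ∸ card D) C k + (n ∸ card D) C suc k
    ≡⟨ nCk+nC[k+1]≡[n+1]C[k+1] (n ∸ card D) k ⟩
  suc (n ∸ card D) C suc k
    ≡⟨ cong (_C suc k) (+-∸-assoc 1 (card≤n D)) ⟨
  (suc n ∸ card D) C suc k ∎
  where open ≡-Reasoning

2^|D|*supersetsOfSize≤nCa : ∀ {n} a (D : SubsetV n) → a + a ≤ n → 2 ^ card D * supersetsOfSize a D ≤ n C a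
2^|D|*supersetsOfSize≤nCa {n} a D a+a≤n with card D ≤? a
... | yes |D|≤a = begin
  2 ^ card D * supersetsOfSize a D
    ≡⟨ cong (λ b → 2 ^ card D * supersetsOfSize b D) (m∸n+n≡m |D|≤a) ⟨
  2 ^ card D * supersetsOfSize (a ∸ card D + card D) D
    ≡⟨ cong (2 ^ card D *_) (supersetsOfSize-exact D (a ∸ card D)) ⟩
  2 ^ card D * ((n ∸ card D) C (a ∸ card D))
    ≤⟨ 2^d*[n∸d]C[a∸d]≤nCa (card D) n a |D|≤a a+a≤n ⟩
  n C a ∎
  where open ≤-Reasoning
... | no |D|≰a = ≤-trans (≤-reflexive (trans (cong (2 ^ card D *_) vanish) (*-zeroʳ (2 ^ card D)))) z≤n
  where
  vanish : supersetsOfSize a D ≡ 0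
  vanish = supersetsOfSize-vanish a D (≰⇒> |D|≰a)

differenceSet : ∀ {n} → Point n → Point n → SubsetV n
differenceSet = zipWith _xor_

⌊≟B⌋≡not-xor : ∀ b c → ⌊ b ≟B c ⌋ ≡ not (b xor c)
⌊≟B⌋≡not-xor true true = refl
⌊≟B⌋≡not-xor true false = refl
⌊≟B⌋≡not-xor false true = refl
⌊≟B⌋≡not-xor false false = refl

agreeOffB≡differenceSet⊆ᵇ : ∀ {n} (A : SubsetV n) (x y : Point n) → agreeOffB A x y ≡ differenceSet x y ⊆ᵇ A
agreeOffB≡differenceSet⊆ᵇ [] [] [] = refl
agreeOffB≡differenceSet⊆ᵇ (s ∷ A) (b ∷ x) (c ∷ y) =
  cong₂ _∧_ (cong (s ∨_) (⌊≟B⌋≡not-xor b c)) (agreeOffB≡differenceSet⊆ᵇ A x y)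

weightOn≤weightOn+distance : ∀ {n} (A : SubsetV n) (x y : Point n) →
  weightOn A x ≤ weightOn A y + card (differenceSet x y)
weightOn≤weightOn+distance [] [] [] = z≤n
weightOn≤weightOn+distance (false ∷ A) (true ∷ x) (true ∷ y) = weightOn≤weightOn+distance A x y
weightOn≤weightOn+distance (false ∷ A) (false ∷ x) (false ∷ y) = weightOn≤weightOn+distance A x y
weightOn≤weightOn+distance (false ∷ A) (true ∷ x) (false ∷ y) =
  ≤-trans (weightOn≤weightOn+distance A x y) (+-monoʳ-≤ _ (n≤1+n _))
weightOn≤weightOn+distance (false ∷ A) (false ∷ x) (true ∷ y) =
  ≤-trans (weightOn≤weightOn+distance A x y) (+-monoʳ-≤ _ (n≤1+n _))
weightOn≤weightOn+distance (true ∷ A) (true ∷ x) (true ∷ y) = s≤s (weightOn≤weightOn+distance A x y)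
weightOn≤weightOn+distance (true ∷ A) (false ∷ x) (false ∷ y) = weightOn≤weightOn+distance A x y
weightOn≤weightOn+distance (true ∷ A) (true ∷ x) (false ∷ y) =
  ≤-trans (s≤s (weightOn≤weightOn+distance A x y)) (≤-reflexive (sym (+-suc _ _)))
weightOn≤weightOn+distance (true ∷ A) (false ∷ x) (true ∷ y) =
  ≤-trans (weightOn≤weightOn+distance A x y) (+-mono-≤ (n≤1+n _) (n≤1+n _))

highB-lowB-gap : ∀ a wx wy d → T (highB a wx) → T (lowB a wy) → wx ≤ wy + d → a + a < (20 * d) ^ 2
highB-lowB-gap a wx wy d high low wx≤wy+d =
  <-≤-trans (+-mono-< a<u² a<v²) (≤-trans (u²+v²≤[u+v]² u v) (^-monoˡ-≤ 2 u+v≤20d))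
  where
  u = 20 * wx ∸ 10 * a
  v = 10 * a ∸ 20 * wy
  high′ = Equivalence.to T-∧ high
  low′ = Equivalence.to T-∧ low
  a<u² : a < u ^ 2
  a<u² = <ᵇ⇒< a (u ^ 2) (proj₂ high′)
  a<v² : a < v ^ 2
  a<v² = <ᵇ⇒< a (v ^ 2) (proj₂ low′)
  u²+v²≤[u+v]² : ∀ u v → u ^ 2 + v ^ 2 ≤ (u + v) ^ 2
  u²+v²≤[u+v]² u v = ≤-trans (m≤m+n (u ^ 2 + v ^ 2) (2 * (u * v))) (≤-reflexive (square-expand u v))
    where
    square-expand : ∀ u v → u * (u * 1) + v * (v * 1) + 2 * (u * v) ≡ (u + v) * ((u + v) * 1)
    square-expand = solve-∀
  u+v≤20d : u + v ≤ 20 * d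
  u+v≤20d = +-cancelʳ-≤ (20 * wy) (u + v) (20 * d) (begin
    u + v + 20 * wy       ≡⟨ +-assoc u v (20 * wy) ⟩
    u + (v + 20 * wy)     ≡⟨ cong (u +_) (m∸n+n≡m (≤ᵇ⇒≤ (20 * wy) (10 * a) (proj₁ low′))) ⟩
    u + 10 * a            ≡⟨ m∸n+n≡m (≤ᵇ⇒≤ (10 * a) (20 * wx) (proj₁ high′)) ⟩
    20 * wx               ≤⟨ *-monoʳ-≤ 20 wx≤wy+d ⟩
    20 * (wy + d)         ≡⟨ *-distribˡ-+ 20 wy d ⟩
    20 * wy + 20 * d      ≡⟨ +-comm (20 * wy) (20 * d) ⟩
    20 * d + 20 * wy ∎)
    where open ≤-Reasoning

pairBadCount : ∀ {n} → ℕ → Point n → Point n → ℕ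
pairBadCount {n} a x y = count
  (λ A → ⌊ card A ≟ a ⌋ ∧ (agreeOffB A x y ∧ highB a (weightOn A x) ∧ lowB a (weightOn A y)))
  (allSubsets n)

badCount≤∑∑pairBadCount : ∀ n a (Q : List (Point n)) →
  badCount n a Q ≤ sum (map (λ x → sum (map (λ y → pairBadCount a x y) Q)) Q)
badCount≤∑∑pairBadCount n a Q = ≤-trans
  (count-≤-sum (λ x A → ⌊ card A ≟ a ⌋ ∧ any (λ y → bad x y A) Q) Q (some (λ x A → any (λ y → bad x y A) Q)) S)
  (sum-map-mono (λ x → count-≤-sum (λ y A → ⌊ card A ≟ a ⌋ ∧ bad x y A) Q (some (λ y → bad x y)) S) Q)
  where
  S = allSubsets n
  bad : Point n → Point n → SubsetV n → Bool
  bad x y A = agreeOffB A x y ∧ highB a (weightOn A x) ∧ lowB a (weightOn A y)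
  some : ∀ (f : Point n → SubsetV n → Bool) A → T (⌊ card A ≟ a ⌋ ∧ any (λ z → f z A) Q) →
    Any (λ z → T (⌊ card A ≟ a ⌋ ∧ f z A)) Q
  some f A t with Equivalence.to T-∧ t
  ... | sized , fs = Any.map (λ fz → Equivalence.from T-∧ (sized , fz)) (any⁻ (λ z → f z A) Q fs)

pairBadCount≤supersetsOfSize : ∀ {n} a (x y : Point n) → pairBadCount a x y ≤ supersetsOfSize a (differenceSet x y)
pairBadCount≤supersetsOfSize {n} a x y = count-mono agreeing (allSubsets n)
  where
  agreeing : ∀ A → T (⌊ card A ≟ a ⌋ ∧ (agreeOffB A x y ∧ _)) → T (⌊ card A ≟ a ⌋ ∧ differenceSet x y ⊆ᵇ A)
  agreeing A t with Equivalence.to T-∧ t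
  ... | sized , rest = Equivalence.from T-∧
    (sized , subst T (agreeOffB≡differenceSet⊆ᵇ A x y) (proj₁ (Equivalence.to T-∧ rest)))

pairBadCount-close : ∀ {n} a (x y : Point n) → ¬ (a + a < (20 * card (differenceSet x y)) ^ 2) →
  pairBadCount a x y ≡ 0
pairBadCount-close {n} a x y close = count-none never (allSubsets n)
  where
  never : ∀ A → ¬ T (⌊ card A ≟ a ⌋ ∧ (agreeOffB A x y ∧ highB a (weightOn A x) ∧ lowB a (weightOn A y)))
  never A t with Equivalence.to (T-∧ {⌊ card A ≟ a ⌋}) t
  ... | _ , bad with Equivalence.to (T-∧ {agreeOffB A x y}) bad
  ... | _ , high∧low with Equivalence.to (T-∧ {highB a (weightOn A x)}) high∧low
  ... | high , low = close (highB-lowB-gap a (weightOn A x) (weightOn A y) (card (differenceSet x y))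
    high low (weightOn≤weightOn+distance A x y))

n<2^n : ∀ n → n < 2 ^ n
n<2^n zero = s≤s z≤n
n<2^n (suc n) = begin-strict
  suc n           <⟨ s≤s (n<2^n n) ⟩
  suc (2 ^ n)     ≤⟨ +-monoˡ-≤ (2 ^ n) (m^n>0 2 n) ⟩
  2 ^ n + 2 ^ n   ≡⟨ cong (2 ^ n +_) (+-identityʳ (2 ^ n)) ⟨
  2 ^ suc n ∎
  where open ≤-Reasoning

[m*n]^o≡m^o*n^o : ∀ m n o → (m * n) ^ o ≡ m ^ o * n ^ o
[m*n]^o≡m^o*n^o m n zero = refl
[m*n]^o≡m^o*n^o m n (suc o) = trans (cong (m * n *_) ([m*n]^o≡m^o*n^o m n o)) (interchange m n (m ^ o) (n ^ o))
  where
  interchange : ∀ a b c d → a * b * (c * d) ≡ a * c * (b * d)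
  interchange = solve-∀

^-cancelˡ-≤ : ∀ o .{{_ : NonZero o}} {m n} → m ^ o ≤ n ^ o → m ≤ n
^-cancelˡ-≤ o mᵒ≤nᵒ = ≮⇒≥ (λ n<m → <⇒≱ (^-monoˡ-< o n<m) mᵒ≤nᵒ)

L*[L*K]≤2^d : ∀ K L d → L ^ 100 ≤ 2 ^ (20 * d) → 50 * K ≤ d → L * (L * K) ≤ 2 ^ d
L*[L*K]≤2^d K L d L¹⁰⁰≤2²⁰ᵈ 50K≤d = ^-cancelˡ-≤ 50 (begin
  (L * (L * K)) ^ 50              ≡⟨ [m*n]^o≡m^o*n^o L (L * K) 50 ⟩
  L ^ 50 * (L * K) ^ 50           ≡⟨ cong (L ^ 50 *_) ([m*n]^o≡m^o*n^o L K 50) ⟩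
  L ^ 50 * (L ^ 50 * K ^ 50)      ≡⟨ *-assoc (L ^ 50) (L ^ 50) (K ^ 50) ⟨
  L ^ 50 * L ^ 50 * K ^ 50        ≡⟨ cong (_* K ^ 50) (^-distribˡ-+-* L 50 50) ⟨
  L ^ 100 * K ^ 50                ≤⟨ *-mono-≤ L¹⁰⁰≤2²⁰ᵈ K⁵⁰≤2³⁰ᵈ ⟩
  2 ^ (20 * d) * 2 ^ (30 * d)     ≡⟨ ^-distribˡ-+-* 2 (20 * d) (30 * d) ⟨
  2 ^ (20 * d + 30 * d)           ≡⟨ cong (2 ^_) (regroup d) ⟩
  2 ^ (d * 50)                    ≡⟨ ^-*-assoc 2 d 50 ⟨
  (2 ^ d) ^ 50 ∎)
  where
  open ≤-Reasoning
  regroup : ∀ d → 20 * d + 30 * d ≡ d * 50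
  regroup = solve-∀
  K⁵⁰≤2³⁰ᵈ : K ^ 50 ≤ 2 ^ (30 * d)
  K⁵⁰≤2³⁰ᵈ = begin
    K ^ 50          ≤⟨ ^-monoˡ-≤ 50 (<⇒≤ (n<2^n K)) ⟩
    (2 ^ K) ^ 50    ≡⟨ ^-*-assoc 2 K 50 ⟩
    2 ^ (K * 50)    ≤⟨ ^-monoʳ-≤ 2 (≤-trans (≤-reflexive (*-comm K 50)) (≤-trans 50K≤d (m≤n*m d 30))) ⟩
    2 ^ (30 * d) ∎

threshold⇒c≤d : ∀ c d m → 200 * (c * c) ≤ m → m + m < (20 * d) ^ 2 → c ≤ d
threshold⇒c≤d c d m 200c²≤m m+m<[20d]² = ≮⇒≥ λ d<c → <⇒≱ m+m<[20d]² (begin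
  (20 * d) ^ 2                  ≤⟨ ^-monoˡ-≤ 2 (*-monoʳ-≤ 20 (<⇒≤ d<c)) ⟩
  (20 * c) ^ 2                  ≡⟨ square c ⟩
  200 * (c * c) + 200 * (c * c) ≤⟨ +-mono-≤ 200c²≤m 200c²≤m ⟩
  m + m ∎)
  where
  open ≤-Reasoning
  square : ∀ c → (20 * c) * ((20 * c) * 1) ≡ 200 * (c * c) + 200 * (c * c)
  square = solve-∀

pairBadCount-share : ∀ K m (Q : List (Point (m + m))) → 200 * (50 * K * (50 * K)) ≤ m →
  QueryBound (m + m) (length Q) →
  ∀ x y → length Q * (length Q * K * pairBadCount m x y) ≤ (m + m) C m
pairBadCount-share K m Q threshold bound x y with (m + m) <? (20 * d) ^ 2
  where d = card (differenceSet x y)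
... | no close = ≤-trans (≤-reflexive vanish) z≤n
  where
  vanish : length Q * (length Q * K * pairBadCount m x y) ≡ 0
  vanish = begin
    length Q * (length Q * K * pairBadCount m x y) ≡⟨ cong (λ z → length Q * (length Q * K * z)) (pairBadCount-close m x y close) ⟩
    length Q * (length Q * K * 0)                  ≡⟨ cong (length Q *_) (*-zeroʳ (length Q * K)) ⟩
    length Q * 0                                   ≡⟨ *-zeroʳ (length Q) ⟩
    0 ∎
    where open ≡-Reasoning
... | yes far = begin
  L * (L * K * pairBadCount m x y)              ≡⟨ *-assoc L (L * K) _ ⟨
  L * (L * K) * pairBadCount m x y              ≤⟨ *-monoˡ-≤ (pairBadCount m x y) (L*[L*K]≤2^d K L d L¹⁰⁰≤2²⁰ᵈ 50K≤d) ⟩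
  2 ^ d * pairBadCount m x y                    ≤⟨ *-monoʳ-≤ (2 ^ d) (pairBadCount≤supersetsOfSize m x y) ⟩
  2 ^ d * supersetsOfSize m (differenceSet x y) ≤⟨ 2^|D|*supersetsOfSize≤nCa m (differenceSet x y) ≤-refl ⟩
  (m + m) C m ∎
  where
  open ≤-Reasoning
  L = length Q
  d = card (differenceSet x y)
  L¹⁰⁰≤2²⁰ᵈ : L ^ 100 ≤ 2 ^ (20 * d)
  -- the query bound at the rational 20d / 1, which exceeds √(2m)
  L¹⁰⁰≤2²⁰ᵈ = bound (20 * d) 1 (s≤s z≤n) (subst (_< (20 * d) ^ 2) (sym (*-identityʳ (m + m))) far)
  50K≤d : 50 * K ≤ d
  50K≤d = threshold⇒c≤d (50 * K) d m threshold far

lemma5p3 : ∀ (k : ℕ) → ∃[ N ] ∀ (m : ℕ) → N ≤ m →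
    ∀ (Q : List (Point (m + m))) → QueryBound (m + m) (length Q) →
    suc k * badCount (m + m) m Q ≤ (m + m) C m
lemma5p3 k = 200 * (50 * suc k * (50 * suc k)) , λ m threshold Q bound → begin
  suc k * badCount (m + m) m Q
    ≤⟨ *-monoʳ-≤ (suc k) (badCount≤∑∑pairBadCount (m + m) m Q) ⟩
  suc k * sum (map (λ x → sum (map (λ y → pairBadCount m x y) Q)) Q)
    ≤⟨ *-sum-≤ (suc k) _ _ Q (λ x → ≤-trans (≤-reflexive (sym (*-assoc (length Q) (suc k) _)))
         (*-sum-≤ (length Q * suc k) _ (pairBadCount m x) Q (pairBadCount-share (suc k) m Q threshold bound x))) ⟩
  (m + m) C m ∎
  where open ≤-Reasoning
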